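{- Let $k\ge 2$ and let $e_1,\dots,e_k$ be nonnegative integers with $e_1+\dots+e_k=\binom{2k}{2}+\frac{3k^2-7k+2}{2}$. Then there is a Gallai coloring of $K_{2k}$ with colors from $\{1,\dots,k\}$ in which, for every $i$, at most $e_i$ edges receive color $i$; moreover such a coloring can be obtained by repeatedly splitting a largest remaining complete graph $K_a$ into two vertex-disjoint complete graphs $K_{a_1},K_{a_2}$ ($a_1+a_2=a$) and coloring all $a_1a_2$ edges between them with one color $i$ whose remaining budget is at least $a_1a_2$ (then reducing that budget by $a_1a_2$), until only single vertices remain.
   Context: A Gallai coloring of $K_n$ is an edge coloring with no triangle colored with three distinct colors. -}

module Defs where

open import Data.Nat using (ℕ; _+_; _*_; _∸_; _≤_; _<_)
open import Data.Nat.Combinatorics using (_C_)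
open import Data.Fin using (Fin; toℕ; _≟_)
open import Data.Bool using (if_then_else_)
open import Data.List using (List; []; _∷_; _++_; length; allFin; filter; concatMap; map; [_])
open import Data.Nat.ListAction using (sum)
open import Data.List.Relation.Unary.All using (All)
open import Data.List.Membership.Propositional using (_∈_)
open import Data.List.Relation.Binary.Permutation.Propositional using (_↭_)
open import Data.Product using (_×_; _,_)
open import Data.Sum using (_⊎_)
open import Relation.Nullary using (¬_; does)
open import Relation.Binary.PropositionalEquality using (_≡_)

-- An edge colouring of K_n with colours Fin k (colour i ∈ Fin k stands for
-- colour i+1 ∈ {1,…,k}).  The value c x x on the diagonal is irrelevant;
-- the colour of the edge {x,y} (x ≠ y) is c x y = c y x.
Coloring : ℕ → ℕ → Set
Coloring n k = Fin n → Fin n → Fin k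

Symmetric : ∀ {n k} → Coloring n k → Set
Symmetric {n} c = (x y : Fin n) → c x y ≡ c y x

Gallai : ∀ {n k} → Coloring n k → Set
Gallai {n} c = (x y z : Fin n) → ¬ (x ≡ y) → ¬ (y ≡ z) → ¬ (x ≡ z) →
  ¬ (¬ (c x y ≡ c y z) × ¬ (c y z ≡ c x z) × ¬ (c x y ≡ c x z))

edges : (n : ℕ) → List (Fin n × Fin n)
edges n = concatMap (λ x → map (λ y → (x , y))
                               (filter (λ y → toℕ x Data.Nat.<? toℕ y) (allFin n)))
                    (allFin n)
  where import Data.Nat

count : ∀ {n k} → Coloring n k → Fin k → ℕ
count {n} c i = length (filter (λ e → c (Data.Product.proj₁ e) (Data.Product.proj₂ e) ≟ i) (edges n))
  where import Data.Product

sumFin : (k : ℕ) → (Fin k → ℕ) → ℕ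
sumFin k e = sum (map e (allFin k))

spend : ∀ {k} → (Fin k → ℕ) → Fin k → ℕ → (Fin k → ℕ)
spend b i m j = if does (j ≟ i) then b j ∸ m else b j

-- The splitting process, run against a fixed colouring c.
-- A state consists of the list of remaining complete graphs (as vertex
-- blocks) and the remaining budget of each colour.
data Run {n k : ℕ} (c : Coloring n k) : List (List (Fin n)) → (Fin k → ℕ) → Set where
  done : ∀ {bs b} → All (λ B → length B ≤ 1) bs → Run c bs b
  step : ∀ {bs b} (B B₁ B₂ : List (Fin n)) (rest : List (List (Fin n))) (i : Fin k) →
         bs ↭ (B ∷ rest) →
         All (λ B' → length B' ≤ length B) rest →
         B ↭ (B₁ ++ B₂) →
         1 ≤ length B₁ → 1 ≤ length B₂ →
         length B₁ * length B₂ ≤ b i →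
         (∀ x y → x ∈ B₁ → y ∈ B₂ → c x y ≡ i) →
         Run c (B₁ ∷ B₂ ∷ rest) (spend b i (length B₁ * length B₂)) →
         Run c bs b

-- Build the colouring as an iterated cone: each vertex in turn is split off from the block
-- of all later vertices and joined to it in one colour, so every triangle has two edges of the
-- colour of its first vertex.  When s + 1 vertices remain, the splitting costs s edges and we
-- take any colour that can still afford s.  The invariant Σ b ≥ C(s+1,2) + C(k−1,2) guarantees
-- one: if every budget were below s then Σ b ≤ k(s−1) < C(s+1,2) + C(k−1,2).  The invariant
-- survives the step, since both sides drop by s, and holds initially because
-- (3k² − 7k + 2)/2 ≥ C(k−1,2) for k ≥ 2.
module Submission where

open import Defs
open import Data.Nat using (ℕ; _+_; _*_; _≤_)
open import Data.Nat.Combinatorics using (_C_)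
open import Data.Fin using (Fin)
open import Data.List using (allFin; [_])
open import Data.Product using (Σ; _×_)
open import Relation.Binary.PropositionalEquality using (_≡_)

open import Function using (_∘_)
open import Data.Nat using (zero; suc; _∸_; _<?_; _≤?_; z≤n; s≤s; s≤s⁻¹)
open import Data.Nat.Properties
  using (≤-trans; ≤-reflexive; ≤-pred; <-irrefl; ≰⇒>; +-assoc; +-commutativeSemigroup;
         +-mono-≤; +-monoˡ-≤; +-monoʳ-≤; *-monoʳ-≤; *-identityˡ; *-distribˡ-+; +-cancelʳ-≤;
         m≤m+n; m∸n+n≡m; m+[n∸m]≡n; module ≤-Reasoning)
open import Algebra.Properties.CommutativeSemigroup +-commutativeSemigroup using (xy∙z≈xz∙y)
open import Data.Nat.Combinatorics using (nC1≡n; nCk+nC[k+1]≡[n+1]C[k+1])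
open import Data.Nat.ListAction using (sum)
open import Data.Nat.Tactic.RingSolver using (solve-∀)
open import Data.Fin using (zero; suc; toℕ; _≟_)
open import Data.Fin.Properties using (any?)
open import Data.List using (List; []; _∷_; _++_; length; map; filter; concatMap; tabulate)
open import Data.List.Properties
  using (length-++; length-map; length-tabulate; map-tabulate; map-++; map-∘; filter-++; filter-all;
         filter-none; filter-≐; concatMap-map; map-concatMap; concatMap-cong)
open import Data.List.Relation.Unary.All as All using (All; []; _∷_)
open import Data.List.Relation.Unary.All.Properties using (++⁺) renaming (map⁺ to All-map⁺)
open import Data.List.Relation.Unary.Any using (here)
open import Data.List.Membership.Propositional using (_∈_)
open import Data.List.Membership.Propositional.Properties using (∈-map⁻)
open import Data.List.Relation.Binary.Permutation.Propositional
  using (_↭_; ↭-refl; ↭-reflexive; ↭-sym; ↭-trans; swap)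
open import Data.List.Relation.Binary.Permutation.Propositional.Properties
  using (All-resp-↭; ↭-length; ++⁺ʳ) renaming (map⁺ to ↭-map⁺)
open import Data.Product using (_,_; proj₁; proj₂; ∃)
open import Data.Empty using (⊥-elim)
open import Data.Bool using (true; false; if_then_else_)
open import Relation.Nullary using (does; yes; no)
open import Relation.Unary using (Decidable)
open import Relation.Binary.PropositionalEquality
  using (refl; sym; trans; cong; cong₂; subst; subst₂; module ≡-Reasoning)

-- Both sides grow by 2t + 2k + 5 when t and k are both incremented, so only t = 0 or k = 0
-- needs checking; the difference of the two sides is (t − k + 1)(t − k + 2).
quadratic-gap : ∀ t k → 2 * (k * t) + 3 * k ≤ t * t + 3 * t + k * k + 2
quadratic-gap t zero = z≤n
quadratic-gap zero (suc zero) = ≤-reflexive refl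
quadratic-gap zero (suc (suc j)) = begin
  2 * (suc (suc j) * 0) + 3 * suc (suc j)              ≤⟨ m≤m+n _ (j * suc j) ⟩
  2 * (suc (suc j) * 0) + 3 * suc (suc j) + j * suc j  ≡⟨ expand j ⟩
  0 * 0 + 3 * 0 + suc (suc j) * suc (suc j) + 2        ∎
  where
  open ≤-Reasoning
  expand : ∀ j → 2 * (suc (suc j) * 0) + 3 * suc (suc j) + j * suc j
               ≡ 0 * 0 + 3 * 0 + suc (suc j) * suc (suc j) + 2
  expand = solve-∀
quadratic-gap (suc t) (suc k) = begin
  2 * (suc k * suc t) + 3 * suc k                 ≡⟨ shiftˡ t k ⟩
  2 * (k * t) + 3 * k + (2 * t + 2 * k + 5)       ≤⟨ +-monoˡ-≤ _ (quadratic-gap t k) ⟩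
  t * t + 3 * t + k * k + 2 + (2 * t + 2 * k + 5) ≡⟨ shiftʳ t k ⟩
  suc t * suc t + 3 * suc t + suc k * suc k + 2   ∎
  where
  open ≤-Reasoning
  shiftˡ : ∀ t k → 2 * (suc k * suc t) + 3 * suc k ≡ 2 * (k * t) + 3 * k + (2 * t + 2 * k + 5)
  shiftˡ = solve-∀
  shiftʳ : ∀ t k → t * t + 3 * t + k * k + 2 + (2 * t + 2 * k + 5)
                 ≡ suc t * suc t + 3 * suc t + suc k * suc k + 2
  shiftʳ = solve-∀

2*[1+n]C2≡[1+n]*n : ∀ n → 2 * (suc n C 2) ≡ suc n * n
2*[1+n]C2≡[1+n]*n zero = refl
2*[1+n]C2≡[1+n]*n (suc n) = begin
  2 * (suc (suc n) C 2)             ≡⟨ cong (2 *_) (sym (nCk+nC[k+1]≡[n+1]C[k+1] (suc n) 1)) ⟩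
  2 * (suc n C 1 + suc n C 2)       ≡⟨ cong (λ m → 2 * (m + suc n C 2)) (nC1≡n (suc n)) ⟩
  2 * (suc n + suc n C 2)           ≡⟨ *-distribˡ-+ 2 (suc n) (suc n C 2) ⟩
  2 * suc n + 2 * (suc n C 2)       ≡⟨ cong (2 * suc n +_) (2*[1+n]C2≡[1+n]*n n) ⟩
  2 * suc n + suc n * n             ≡⟨ square n ⟩
  suc (suc n) * suc n               ∎
  where
  open ≡-Reasoning
  square : ∀ n → 2 * suc n + suc n * n ≡ suc (suc n) * suc n
  square = solve-∀

sumFin-suc : ∀ {k} (b : Fin (suc k) → ℕ) → sumFin (suc k) b ≡ b zero + sumFin k (b ∘ suc)
sumFin-suc b =
  cong (λ bs → b zero + sum bs) (trans (map-tabulate suc b) (sym (map-tabulate (λ i → i) (b ∘ suc))))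

sumFin-≤ : ∀ {k M} (b : Fin k → ℕ) → (∀ i → b i ≤ M) → sumFin k b ≤ k * M
sumFin-≤ {zero} b _ = z≤n
sumFin-≤ {suc k} b b≤M rewrite sumFin-suc b = +-mono-≤ (b≤M zero) (sumFin-≤ (b ∘ suc) (b≤M ∘ suc))

sumFin-spend : ∀ {k m} (b : Fin k → ℕ) (a : Fin k) → m ≤ b a → sumFin k (spend b a m) + m ≡ sumFin k b
sumFin-spend {suc k} {m} b zero m≤ba = begin
  sumFin (suc k) (spend b zero m) + m    ≡⟨ cong (_+ m) (sumFin-suc (spend b zero m)) ⟩
  b zero ∸ m + sumFin k (b ∘ suc) + m    ≡⟨ xy∙z≈xz∙y (b zero ∸ m) _ m ⟩
  b zero ∸ m + m + sumFin k (b ∘ suc)    ≡⟨ cong (_+ sumFin k (b ∘ suc)) (m∸n+n≡m m≤ba) ⟩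
  b zero + sumFin k (b ∘ suc)            ≡⟨ sym (sumFin-suc b) ⟩
  sumFin (suc k) b                       ∎
  where open ≡-Reasoning
sumFin-spend {suc k} {m} b (suc a) m≤ba = begin
  sumFin (suc k) (spend b (suc a) m) + m        ≡⟨ cong (_+ m) (sumFin-suc (spend b (suc a) m)) ⟩
  b zero + sumFin k (spend (b ∘ suc) a m) + m   ≡⟨ +-assoc (b zero) _ m ⟩
  b zero + (sumFin k (spend (b ∘ suc) a m) + m) ≡⟨ cong (b zero +_) (sumFin-spend (b ∘ suc) a m≤ba) ⟩
  b zero + sumFin k (b ∘ suc)                   ≡⟨ sym (sumFin-suc b) ⟩
  sumFin (suc k) b                              ∎
  where open ≡-Reasoning

-- Σ b ≥ C(s+1,2) + C(k−1,2), doubled and with 3k moved to the right to avoid truncated subtraction.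
Feasible : ∀ {k} → (Fin k → ℕ) → ℕ → Set
Feasible {k} b s = suc s * s + k * k + 2 ≤ 2 * sumFin k b + 3 * k

affordable : ∀ {k s} (b : Fin k → ℕ) → Feasible b (suc s) → ∃ λ a → suc s ≤ b a
affordable {k} {s} b feasible with any? (λ a → suc s ≤? b a)
... | yes found = found
... | no none = ⊥-elim (<-irrefl refl (begin-strict
  2 * sumFin k b + 3 * k             ≤⟨ +-monoˡ-≤ (3 * k) (*-monoʳ-≤ 2 (sumFin-≤ b b≤s)) ⟩
  2 * (k * s) + 3 * k                ≤⟨ quadratic-gap s k ⟩
  s * s + 3 * s + k * k + 2          <⟨ m≤m+n _ 1 ⟩
  suc (s * s + 3 * s + k * k + 2) + 1 ≡⟨ expand s (k * k) ⟩
  suc (suc s) * suc s + k * k + 2    ≤⟨ feasible ⟩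
  2 * sumFin k b + 3 * k             ∎))
  where
  open ≤-Reasoning
  b≤s : ∀ a → b a ≤ s
  b≤s a = ≤-pred (≰⇒> (λ affords → none (a , affords)))
  expand : ∀ s K → suc (s * s + 3 * s + K + 2) + 1 ≡ suc (suc s) * suc s + K + 2
  expand = solve-∀

feasible-spend : ∀ {k s} (b : Fin k → ℕ) (a : Fin k) → suc s ≤ b a →
                 Feasible b (suc s) → Feasible (spend b a (suc s)) s
feasible-spend {k} {s} b a affords feasible = +-cancelʳ-≤ (2 * suc s) _ _ (begin
  suc s * s + k * k + 2 + 2 * suc s ≡⟨ expand s (k * k) ⟩
  suc (suc s) * suc s + k * k + 2   ≤⟨ feasible ⟩
  2 * sumFin k b + 3 * k            ≡⟨ cong (λ S → 2 * S + 3 * k) (sym (sumFin-spend b a affords)) ⟩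
  2 * (S′ + suc s) + 3 * k          ≡⟨ distrib S′ (suc s) (3 * k) ⟩
  2 * S′ + 3 * k + 2 * suc s        ∎)
  where
  open ≤-Reasoning
  S′ = sumFin k (spend b a (suc s))
  expand : ∀ s K → suc s * s + K + 2 + 2 * suc s ≡ suc (suc s) * suc s + K + 2
  expand = solve-∀
  distrib : ∀ S m K → 2 * (S + m) + K ≡ 2 * S + K + 2 * m
  distrib = solve-∀

initial-feasible : ∀ {k} (e : Fin k → ℕ) → 2 ≤ k →
                   2 * sumFin k e + 7 * k ≡ 2 * ((2 * k) C 2) + 3 * k * k + 2 → Feasible e (2 * k ∸ 1)
initial-feasible {suc zero} e (s≤s ()) budget
initial-feasible {suc (suc t)} e _ budget = +-cancelʳ-≤ (4 * k) _ _ (begin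
  suc s * s + k * k + 2 + 4 * k
    ≡⟨ cong (λ x → x + k * k + 2 + 4 * k) (sym (2*[1+n]C2≡[1+n]*n s)) ⟩
  2 * ((2 * k) C 2) + k * k + 2 + 4 * k              ≤⟨ m≤m+n _ (2 * (k * t)) ⟩
  2 * ((2 * k) C 2) + k * k + 2 + 4 * k + 2 * (k * t) ≡⟨ expand ((2 * k) C 2) t ⟩
  2 * ((2 * k) C 2) + 3 * k * k + 2                  ≡⟨ sym budget ⟩
  2 * sumFin k e + 7 * k                             ≡⟨ split (sumFin k e) t ⟩
  2 * sumFin k e + 3 * k + 4 * k                     ∎)
  where
  open ≤-Reasoning
  k = suc (suc t)
  s = 2 * k ∸ 1
  expand : ∀ C t → 2 * C + suc (suc t) * suc (suc t) + 2 + 4 * suc (suc t) + 2 * (suc (suc t) * t)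
                 ≡ 2 * C + 3 * suc (suc t) * suc (suc t) + 2
  expand = solve-∀
  split : ∀ S t → 2 * S + 7 * suc (suc t) ≡ 2 * S + 3 * suc (suc t) + 4 * suc (suc t)
  split = solve-∀

cone : ∀ {n k} → Fin k → Coloring n k → Coloring (suc n) k
cone a c (suc x) (suc y) = c x y
cone a c _       _       = a

cone-symmetric : ∀ {n k} {a : Fin k} {c : Coloring n k} → Symmetric c → Symmetric (cone a c)
cone-symmetric sym-c zero    zero    = refl
cone-symmetric sym-c zero    (suc y) = refl
cone-symmetric sym-c (suc x) zero    = refl
cone-symmetric sym-c (suc x) (suc y) = sym-c x y

cone-gallai : ∀ {n k} {a : Fin k} {c : Coloring n k} → Gallai c → Gallai (cone a c)
cone-gallai gallai zero    y       z       _ _ _ (_ , _ , ≢₃) = ≢₃ refl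
cone-gallai gallai (suc x) zero    z       _ _ _ (≢₁ , _ , _) = ≢₁ refl
cone-gallai gallai (suc x) (suc y) zero    _ _ _ (_ , ≢₂ , _) = ≢₂ refl
cone-gallai gallai (suc x) (suc y) (suc z) x≢y y≢z x≢z =
  gallai x y z (x≢y ∘ cong suc) (y≢z ∘ cong suc) (x≢z ∘ cong suc)

filter-map : ∀ {A B : Set} {P : B → Set} (P? : Decidable P) (f : A → B) xs →
             filter P? (map f xs) ≡ map f (filter (P? ∘ f) xs)
filter-map P? f []       = refl
filter-map P? f (x ∷ xs) with does (P? (f x))
... | true  = cong (f x ∷_) (filter-map P? f xs)
... | false = filter-map P? f xs

length-filter-map : ∀ {A B : Set} {P : B → Set} (P? : Decidable P) (f : A → B) xs →
                    length (filter P? (map f xs)) ≡ length (filter (P? ∘ f) xs)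
length-filter-map P? f xs = trans (cong length (filter-map P? f xs)) (length-map f (filter (P? ∘ f) xs))

suc² : ∀ {n} → Fin n × Fin n → Fin (suc n) × Fin (suc n)
suc² (x , y) = suc x , suc y

edges-suc : ∀ n → edges (suc n) ≡ map (λ y → zero , suc y) (allFin n) ++ map suc² (edges n)
edges-suc n = cong₂ _++_ spokes (begin
  concatMap later (tabulate suc)           ≡⟨ cong (concatMap later) (sym (map-tabulate (λ i → i) suc)) ⟩
  concatMap later (map suc (allFin n))     ≡⟨ concatMap-map later suc (allFin n) ⟩
  concatMap (later ∘ suc) (allFin n)       ≡⟨ concatMap-cong inner (allFin n) ⟩
  concatMap (map suc² ∘ pairs) (allFin n)  ≡⟨ map-concatMap suc² pairs (allFin n) ⟨
  map suc² (concatMap pairs (allFin n))    ∎)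
  where
  open ≡-Reasoning
  pairs : Fin n → List (Fin n × Fin n)
  pairs x = map (x ,_) (filter (λ y → toℕ x <? toℕ y) (allFin n))
  later : Fin (suc n) → List (Fin (suc n) × Fin (suc n))
  later x = map (x ,_) (filter (λ y → toℕ x <? toℕ y) (allFin (suc n)))
  above : ∀ m → filter (λ y → m <? toℕ y) (tabulate {n = n} suc)
              ≡ map suc (filter (λ y → m <? suc (toℕ y)) (allFin n))
  above m = trans (cong (filter _) (sym (map-tabulate (λ i → i) suc))) (filter-map _ suc (allFin n))
  spokes : later zero ≡ map (λ y → zero , suc y) (allFin n)
  spokes = begin
    map (zero ,_) (filter (λ y → 0 <? toℕ y) (tabulate suc))  ≡⟨ cong (map (zero ,_)) (above 0) ⟩
    map (zero ,_) (map suc (filter (λ y → 0 <? suc (toℕ y)) (allFin n)))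
      ≡⟨ cong (map (zero ,_) ∘ map suc) (filter-all _ (All.universal (λ _ → s≤s z≤n) (allFin n))) ⟩
    map (zero ,_) (map suc (allFin n))   ≡⟨ sym (map-∘ (allFin n)) ⟩
    map (λ y → zero , suc y) (allFin n)  ∎
    where open ≡-Reasoning
  inner : ∀ x → later (suc x) ≡ map suc² (pairs x)
  inner x = begin
    map (suc x ,_) (filter (λ y → suc (toℕ x) <? toℕ y) (tabulate suc))
      ≡⟨ cong (map (suc x ,_)) (above (suc (toℕ x))) ⟩
    map (suc x ,_) (map suc (filter (λ y → suc (toℕ x) <? suc (toℕ y)) (allFin n)))
      ≡⟨ cong (map (suc x ,_) ∘ map suc) (filter-≐ _ _ (s≤s⁻¹ , s≤s) (allFin n)) ⟩
    map (suc x ,_) (map suc (filter (λ y → toℕ x <? toℕ y) (allFin n)))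
      ≡⟨ map-∘ _ ⟨
    map (λ y → suc x , suc y) (filter (λ y → toℕ x <? toℕ y) (allFin n))
      ≡⟨ map-∘ _ ⟩
    map suc² (pairs x)
      ∎

count-cone : ∀ {n k} (a : Fin k) (c : Coloring n k) i →
             count (cone a c) i ≡ (if does (i ≟ a) then n else 0) + count c i
count-cone {n} a c i = begin
  length (filter is-i (edges (suc n)))
    ≡⟨ cong (length ∘ filter is-i) (edges-suc n) ⟩
  length (filter is-i (spokes ++ map suc² (edges n)))
    ≡⟨ cong length (filter-++ is-i spokes _) ⟩
  length (filter is-i spokes ++ filter is-i (map suc² (edges n)))
    ≡⟨ length-++ (filter is-i spokes) ⟩
  length (filter is-i spokes) + length (filter is-i (map suc² (edges n)))
    ≡⟨ cong₂ _+_ (trans (length-filter-map is-i _ (allFin n)) spoke-count)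
                 (length-filter-map is-i suc² (edges n)) ⟩
  (if does (i ≟ a) then n else 0) + count c i
    ∎
  where
  open ≡-Reasoning
  is-i : Decidable (λ e → cone a c (proj₁ e) (proj₂ e) ≡ i)
  is-i e = cone a c (proj₁ e) (proj₂ e) ≟ i
  spokes = map (λ y → zero , suc y) (allFin n)
  spoke-count : length (filter (λ _ → a ≟ i) (allFin n)) ≡ (if does (i ≟ a) then n else 0)
  spoke-count with i ≟ a
  ... | yes refl = trans (cong length (filter-all (λ _ → a ≟ a) (All.universal (λ _ → refl) (allFin n))))
                         (length-tabulate (λ i → i))
  ... | no i≢a   =
    cong length (filter-none (λ _ → a ≟ i) (All.universal (λ _ a≡i → i≢a (sym a≡i)) (allFin n)))

count-cone-≤ : ∀ {n k} {a : Fin k} {c : Coloring n k} {b : Fin k → ℕ} → n ≤ b a →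
               (∀ i → count c i ≤ spend b a n i) → ∀ i → count (cone a c) i ≤ b i
count-cone-≤ {n} {a = a} {c} {b} n≤ba counted i rewrite count-cone a c i with i ≟ a | counted i
... | yes refl | counted-a = begin
  n + count c a   ≤⟨ +-monoʳ-≤ n counted-a ⟩
  n + (b a ∸ n)   ≡⟨ m+[n∸m]≡n n≤ba ⟩
  b a             ∎
  where open ≤-Reasoning
... | no _     | counted-i = counted-i

Run-resp-↭ : ∀ {n k} {c : Coloring n k} {bs bs′ b} → bs ↭ bs′ → Run c bs′ b → Run c bs b
Run-resp-↭ p (done trivial) = done (All-resp-↭ (↭-sym p) trivial)
Run-resp-↭ p (step B B₁ B₂ rest i q largest split 1≤|B₁| 1≤|B₂| affords coloured run) =
  step B B₁ B₂ rest i (↭-trans p q) largest split 1≤|B₁| 1≤|B₂| affords coloured run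

Run-++-singletons : ∀ {n k} {c : Coloring n k} {bs b} ss →
                    All (λ B → length B ≤ 1) ss → Run c bs b → Run c (bs ++ ss) b
Run-++-singletons ss singletons (done trivial) = done (++⁺ trivial singletons)
Run-++-singletons ss singletons (step B B₁ B₂ rest i p largest split 1≤|B₁| 1≤|B₂| affords coloured run) =
  step B B₁ B₂ (rest ++ ss) i (++⁺ʳ ss p) (++⁺ largest (All.map (λ l → ≤-trans l 1≤|B|) singletons))
       split 1≤|B₁| 1≤|B₂| affords coloured (Run-++-singletons ss singletons run)
  where
  1≤|B| : 1 ≤ length B
  1≤|B| = begin
    1                       ≤⟨ 1≤|B₁| ⟩
    length B₁               ≤⟨ m≤m+n (length B₁) (length B₂) ⟩
    length B₁ + length B₂   ≡⟨ length-++ B₁ ⟨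
    length (B₁ ++ B₂)       ≡⟨ ↭-length split ⟨
    length B                ∎
    where open ≤-Reasoning

Run-map : ∀ {m n k} {c′ : Coloring m k} {c : Coloring n k} (f : Fin m → Fin n) →
          (∀ x y → c (f x) (f y) ≡ c′ x y) → ∀ {bs b} → Run c′ bs b → Run c (map (map f) bs) b
Run-map f hom (done trivial) =
  done (All-map⁺ (All.map (λ {B} → subst (_≤ 1) (sym (length-map f B))) trivial))
Run-map {c = c} f hom {b = b} (step B B₁ B₂ rest i p largest split 1≤|B₁| 1≤|B₂| affords coloured run) =
  step (map f B) (map f B₁) (map f B₂) (map (map f) rest) i
       (↭-map⁺ (map f) p)
       (All-map⁺ (All.map (λ {B′} → subst₂ _≤_ (sym (length-map f B′)) (sym (length-map f B))) largest))
       (subst (map f B ↭_) (map-++ f B₁ B₂) (↭-map⁺ f split))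
       (subst (1 ≤_) (sym (length-map f B₁)) 1≤|B₁|)
       (subst (1 ≤_) (sym (length-map f B₂)) 1≤|B₂|)
       (subst (_≤ b i) (sym sizes) affords)
       coloured′
       (subst (Run c (map (map f) (B₁ ∷ B₂ ∷ rest)) ∘ spend b i) (sym sizes) (Run-map f hom run))
  where
  sizes : length (map f B₁) * length (map f B₂) ≡ length B₁ * length B₂
  sizes = cong₂ _*_ (length-map f B₁) (length-map f B₂)
  coloured′ : ∀ x y → x ∈ map f B₁ → y ∈ map f B₂ → c x y ≡ i
  coloured′ x y x∈ y∈ with ∈-map⁻ f x∈ | ∈-map⁻ f y∈
  ... | x′ , x′∈ , refl | y′ , y′∈ , refl = trans (hom x′ y′) (coloured x′ y′ x′∈ y′∈)

Run-cone : ∀ {n k} {a : Fin k} {c : Coloring (suc n) k} {b : Fin k → ℕ} → suc n ≤ b a →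
           Run c [ allFin (suc n) ] (spend b a (suc n)) → Run (cone a c) [ allFin (suc (suc n)) ] b
Run-cone {n} {a = a} {c} {b} affords run =
  step (allFin (suc (suc n))) [ zero ] others [] a ↭-refl []
       (↭-reflexive (cong (zero ∷_) (sym (map-tabulate (λ i → i) suc))))
       (s≤s z≤n) (subst (1 ≤_) (sym |others|) (s≤s z≤n)) (subst (_≤ b a) (sym sizes) affords)
       (λ { _ _ (here refl) _ → refl })
       (Run-resp-↭ (swap [ zero ] others ↭-refl)
         (subst (Run (cone a c) (others ∷ [ zero ] ∷ []) ∘ spend b a) (sym sizes) lifted))
  where
  others = map suc (allFin (suc n))
  |others| : length others ≡ suc n
  |others| = trans (length-map suc (allFin (suc n))) (length-tabulate (λ i → i))
  sizes : 1 * length others ≡ suc n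
  sizes = trans (*-identityˡ (length others)) |others|
  lifted : Run (cone a c) (others ∷ [ zero ] ∷ []) (spend b a (suc n))
  lifted = Run-++-singletons [ [ zero ] ] (s≤s z≤n ∷ []) (Run-map suc (λ _ _ → refl) run)

greedy-splitting : ∀ {k} s (b : Fin (suc k) → ℕ) → Feasible b s →
  Σ (Coloring (suc s) (suc k)) (λ c →
    Symmetric c × Gallai c × ((i : Fin (suc k)) → count c i ≤ b i) × Run c [ allFin (suc s) ] b)
greedy-splitting zero b _ =
  (λ _ _ → zero) , (λ _ _ → refl) , (λ _ _ _ _ _ _ (≢₁ , _) → ≢₁ refl) , (λ _ → z≤n) , done (s≤s z≤n ∷ [])
greedy-splitting (suc s) b feasible with affordable b feasible
... | a , affords with greedy-splitting s (spend b a (suc s)) (feasible-spend b a affords feasible)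
... | c , symmetric , gallai , counted , run =
  cone a c , cone-symmetric symmetric , cone-gallai gallai , count-cone-≤ affords counted , Run-cone affords run

corollary2p11 : (k : ℕ) → 2 ≤ k → (e : Fin k → ℕ) →
    2 * sumFin k e + 7 * k ≡ 2 * ((2 * k) C 2) + 3 * k * k + 2 →
    Σ (Coloring (2 * k) k) (λ c →
      Symmetric c × Gallai c × ((i : Fin k) → count c i ≤ e i) ×
      Run c [ allFin (2 * k) ] e)
corollary2p11 zero () e budget
corollary2p11 (suc k) 2≤k e budget = greedy-splitting (2 * suc k ∸ 1) e (initial-feasible e 2≤k budget)
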